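{- For integers $x\ge 0$ let $$A_3(x)=(-1)^{s_2(\lfloor x/4\rfloor-1)}\Big(3S_{3,0}\big(\lfloor x/4\rfloor\big)-S_{3,0}\big(4\lfloor x/4\rfloor\big)\Big),$$ where for $0\le x\le 3$ the bracket equals $0$ and $A_3(x)$ is taken to be $0$. Then $(A_3(x))_{x\ge0}$ is periodic with period $8$, and $A_3(x)=0$ if $x\equiv 0,1,2,3\pmod 8$, while $A_3(x)=1$ if $x\equiv 4,5,6,7\pmod 8$.
   Context: For an integer $b\ge 2$ and integer $r\ge 0$, $s_b(r)$ denotes the sum of the digits of $r$ in base $b$. For integers $x\ge 0$, define $$S_{3,0}(x)=\sum_{0\le r<x,\; r\equiv 0 \pmod 3}(-1)^{s_{2}(r)}.$$ -}

module Defs where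

open import Data.Nat using (ℕ; zero; suc; _+_; _*_; _∸_; _<_; _≤_)
open import Data.Nat.DivMod using (_/_; _%_)
open import Data.Integer using (ℤ; +_; -_) renaming (_+_ to _+ℤ_; _*_ to _*ℤ_; _-_ to _-ℤ_)

-- binary digit sum s₂(r); fuel r suffices since each step halves r
s₂-fuel : ℕ → ℕ → ℕ
s₂-fuel zero    r = 0
s₂-fuel (suc f) r = r % 2 + s₂-fuel f (r / 2)

s₂ : ℕ → ℕ
s₂ r = s₂-fuel r r

sign : ℕ → ℤ
sign zero    = + 1
sign (suc k) = - sign k

term30 : ℕ → ℤ
term30 r with r % 3
... | zero  = sign (s₂ r)
... | suc _ = + 0

S30 : ℕ → ℤ
S30 zero    = + 0
S30 (suc x) = S30 x +ℤ term30 x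

A3 : ℕ → ℤ
A3 x with x / 4
... | zero  = + 0
... | suc q = sign (s₂ q) *ℤ ((+ 3 *ℤ S30 (suc q)) -ℤ S30 (4 * suc q))

module Submission where

-- Write σ(r) = (-1)^{s₂(r)} (the Thue–Morse sign) and T(m) = Σ_{r<m} σ(r).
--
-- 1. From s₂(2k) = s₂(k) and s₂(2k+1) = s₂(k)+1 the signs on the block
--    4m, 4m+1, 4m+2, 4m+3 are σ(m), -σ(m), -σ(m), σ(m).
-- 2. Since 4m+j ≡ m+j (mod 3), the multiples of 3 in that block are located by
--    m mod 3, and a three-case check gives
--        Σ_{j<4} term30(4m+j) = 3·term30(m) - σ(m).
-- 3. Summing over the blocks below 4m:  3·S₃,₀(m) - S₃,₀(4m) = T(m).
-- 4. Consecutive pairs cancel in T:  T(2s) = 0 and T(2s+1) = σ(s).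
-- 5. For q = ⌊x/4⌋ ≥ 1 we get A₃(x) = σ(q-1)·T(q); with q = 2⌊x/8⌋ + ⌊(x mod 8)/4⌋
--    this is 0 when x mod 8 < 4 and σ(s)² = 1 otherwise; periodicity follows
--    because x and x+8 have the same residue mod 8.

open import Defs
open import Data.Nat using (ℕ; _+_; _<_; _≤_)
open import Data.Nat.DivMod using (_%_)
open import Data.Integer using (ℤ; +_)
open import Data.Product using (_×_)
open import Relation.Binary.PropositionalEquality using (_≡_)

open import Data.Nat using (zero; suc; _*_; z≤n; s≤s; _/_; _<?_)
import Data.Nat.Properties as ℕₚ
open import Data.Nat.DivMod
  using (m/n<m; m/n≤m; m*n/n≡m; m*n%n≡0; m%n<n; m≡m%n+[m/n]*n; [m+kn]%n≡m%n; +-distrib-/; m<n⇒m/n≡0; m/n≡1+[m∸n]/n)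
open import Data.Integer using (-_) renaming (_+_ to _+ℤ_; _*_ to _*ℤ_; _-_ to _-ℤ_)
import Data.Integer.Properties as ℤₚ
open import Data.Product using (_,_)
open import Relation.Binary.PropositionalEquality using (refl; sym; trans; cong; cong₂; subst; module ≡-Reasoning)
open import Relation.Nullary using (yes; no)
import Data.Nat.Tactic.RingSolver as ℕ-Solver
import Data.Integer.Tactic.RingSolver as ℤ-Solver

open ≡-Reasoning

-- The fuelled digit sum does not depend on the fuel once the fuel is at least
-- the argument; this is what turns the definition of s₂ into its recursion.

s₂-fuel-zero : ∀ f → s₂-fuel f 0 ≡ 0
s₂-fuel-zero zero    = refl
s₂-fuel-zero (suc f) = s₂-fuel-zero f

half≤ : ∀ r f → r ≤ suc f → r / 2 ≤ f
half≤ zero    f _       = z≤n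
half≤ (suc r) f (s≤s h) = ℕₚ.≤-trans (ℕₚ.<⇒≤pred (m/n<m (suc r) 2 (s≤s (s≤s z≤n)))) h

s₂-fuel-irrelevant : ∀ f g r → r ≤ f → r ≤ g → s₂-fuel f r ≡ s₂-fuel g r
s₂-fuel-irrelevant zero    g       zero _  _  = sym (s₂-fuel-zero g)
s₂-fuel-irrelevant (suc f) zero    zero _  _  = s₂-fuel-zero (suc f)
s₂-fuel-irrelevant (suc f) (suc g) r    hf hg =
  cong (λ n → r % 2 + n) (s₂-fuel-irrelevant f g (r / 2) (half≤ r f hf) (half≤ r g hg))

s₂-step : ∀ r → s₂ r ≡ r % 2 + s₂ (r / 2)
s₂-step r = begin
  s₂-fuel r r                  ≡⟨ s₂-fuel-irrelevant r (suc r) r ℕₚ.≤-refl (ℕₚ.n≤1+n r) ⟩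
  s₂-fuel (suc r) r            ≡⟨ cong (λ n → r % 2 + n) (s₂-fuel-irrelevant r (r / 2) (r / 2) (m/n≤m r 2) ℕₚ.≤-refl) ⟩
  r % 2 + s₂ (r / 2)           ∎

σ : ℕ → ℤ
σ r = sign (s₂ r)

σ-double : ∀ k → σ (k * 2) ≡ σ k
σ-double k = cong sign (begin
  s₂ (k * 2)                     ≡⟨ s₂-step (k * 2) ⟩
  (k * 2) % 2 + s₂ (k * 2 / 2)   ≡⟨ cong₂ _+_ (m*n%n≡0 k 2) (cong s₂ (m*n/n≡m k 2)) ⟩
  s₂ k                           ∎)

σ-double+1 : ∀ k → σ (1 + k * 2) ≡ - σ k
σ-double+1 k = cong sign (begin
  s₂ (1 + k * 2)                         ≡⟨ s₂-step (1 + k * 2) ⟩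
  (1 + k * 2) % 2 + s₂ ((1 + k * 2) / 2) ≡⟨ cong₂ _+_ ([m+kn]%n≡m%n 1 k 2) (cong s₂ half) ⟩
  suc (s₂ k)                             ∎)
  where
  half : (1 + k * 2) / 2 ≡ k
  half = trans (+-distrib-/ 1 (k * 2) (subst (λ z → 1 + z < 2) (sym (m*n%n≡0 k 2)) (s≤s (s≤s z≤n))))
               (m*n/n≡m k 2)

sign-square : ∀ k → sign k *ℤ sign k ≡ + 1
sign-square zero    = refl
sign-square (suc k) = begin
  - sign k *ℤ - sign k    ≡⟨ sym (ℤₚ.neg-distribˡ-* (sign k) (- sign k)) ⟩
  - (sign k *ℤ - sign k)  ≡⟨ cong -_ (sym (ℤₚ.neg-distribʳ-* (sign k) (sign k))) ⟩
  - - (sign k *ℤ sign k)  ≡⟨ ℤₚ.neg-involutive _ ⟩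
  sign k *ℤ sign k        ≡⟨ sign-square k ⟩
  + 1                     ∎

σ-block₀ : ∀ m → σ (m * 4) ≡ σ m
σ-block₀ m = begin
  σ (m * 4)        ≡⟨ cong σ (ℕₚ.*-assoc m 2 2) ⟨
  σ (m * 2 * 2)    ≡⟨ σ-double (m * 2) ⟩
  σ (m * 2)        ≡⟨ σ-double m ⟩
  σ m              ∎

σ-block₁ : ∀ m → σ (1 + m * 4) ≡ - σ m
σ-block₁ m = begin
  σ (1 + m * 4)       ≡⟨ cong (λ n → σ (1 + n)) (ℕₚ.*-assoc m 2 2) ⟨
  σ (1 + m * 2 * 2)   ≡⟨ σ-double+1 (m * 2) ⟩
  - σ (m * 2)         ≡⟨ cong -_ (σ-double m) ⟩
  - σ m               ∎

σ-block₂ : ∀ m → σ (2 + m * 4) ≡ - σ m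
σ-block₂ m = begin
  σ (2 + m * 4)        ≡⟨ cong σ (eq m) ⟩
  σ ((1 + m * 2) * 2)  ≡⟨ σ-double (1 + m * 2) ⟩
  σ (1 + m * 2)        ≡⟨ σ-double+1 m ⟩
  - σ m                ∎
  where
  eq : ∀ n → 2 + n * 4 ≡ (1 + n * 2) * 2
  eq = ℕ-Solver.solve-∀

σ-block₃ : ∀ m → σ (3 + m * 4) ≡ σ m
σ-block₃ m = begin
  σ (3 + m * 4)            ≡⟨ cong σ (eq m) ⟩
  σ (1 + (1 + m * 2) * 2)  ≡⟨ σ-double+1 (1 + m * 2) ⟩
  - σ (1 + m * 2)          ≡⟨ cong -_ (σ-double+1 m) ⟩
  - - σ m                  ≡⟨ ℤₚ.neg-involutive (σ m) ⟩
  σ m                      ∎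
  where
  eq : ∀ n → 3 + n * 4 ≡ 1 + (1 + n * 2) * 2
  eq = ℕ-Solver.solve-∀

δ₀ : ℕ → ℤ
δ₀ zero    = + 1
δ₀ (suc _) = + 0

term30-as-indicator : ∀ r → term30 r ≡ δ₀ (r % 3) *ℤ σ r
term30-as-indicator r with r % 3
... | zero  = sym (ℤₚ.*-identityˡ (σ r))
... | suc _ = refl

block-residue : ∀ j m → (j + m * 4) % 3 ≡ (j + m % 3) % 3
block-residue j m = begin
  (j + m * 4) % 3                          ≡⟨ cong (λ n → (j + n * 4) % 3) (m≡m%n+[m/n]*n m 3) ⟩
  (j + (m % 3 + m / 3 * 3) * 4) % 3        ≡⟨ cong (_% 3) (regroup j (m % 3) (m / 3)) ⟩
  (j + m % 3 + (m % 3 + m / 3 * 4) * 3) % 3 ≡⟨ [m+kn]%n≡m%n (j + m % 3) (m % 3 + m / 3 * 4) 3 ⟩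
  (j + m % 3) % 3                          ∎
  where
  regroup : ∀ j c t → j + (c + t * 3) * 4 ≡ j + c + (c + t * 4) * 3
  regroup = ℕ-Solver.solve-∀

term30-in-block : ∀ j m {w} → σ (j + m * 4) ≡ w → term30 (j + m * 4) ≡ δ₀ ((j + m % 3) % 3) *ℤ w
term30-in-block j m σ≡w =
  trans (term30-as-indicator (j + m * 4)) (cong₂ _*ℤ_ (cong δ₀ (block-residue j m)) σ≡w)

block-pattern : ∀ c → c < 3 → ∀ v →
  δ₀ ((0 + c) % 3) *ℤ v +ℤ δ₀ ((1 + c) % 3) *ℤ - v +ℤ δ₀ ((2 + c) % 3) *ℤ - v +ℤ δ₀ ((3 + c) % 3) *ℤ v
    ≡ + 3 *ℤ (δ₀ c *ℤ v) -ℤ v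
block-pattern 0 _ = ℤ-Solver.solve-∀
block-pattern 1 _ = ℤ-Solver.solve-∀
block-pattern 2 _ = ℤ-Solver.solve-∀
block-pattern (suc (suc (suc _))) (s≤s (s≤s (s≤s ())))

block-sum : ∀ m → term30 (m * 4) +ℤ term30 (1 + m * 4) +ℤ term30 (2 + m * 4) +ℤ term30 (3 + m * 4)
                  ≡ + 3 *ℤ term30 m -ℤ σ m
block-sum m = begin
  term30 (m * 4) +ℤ term30 (1 + m * 4) +ℤ term30 (2 + m * 4) +ℤ term30 (3 + m * 4)
    ≡⟨ cong₂ _+ℤ_ (cong₂ _+ℤ_ (cong₂ _+ℤ_ (term30-in-block 0 m (σ-block₀ m)) (term30-in-block 1 m (σ-block₁ m)))
                              (term30-in-block 2 m (σ-block₂ m)))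
                  (term30-in-block 3 m (σ-block₃ m)) ⟩
  δ₀ ((0 + c) % 3) *ℤ σ m +ℤ δ₀ ((1 + c) % 3) *ℤ - σ m +ℤ δ₀ ((2 + c) % 3) *ℤ - σ m +ℤ δ₀ ((3 + c) % 3) *ℤ σ m
    ≡⟨ block-pattern c (m%n<n m 3) (σ m) ⟩
  + 3 *ℤ (δ₀ c *ℤ σ m) -ℤ σ m
    ≡⟨ cong (λ t → + 3 *ℤ t -ℤ σ m) (term30-as-indicator m) ⟨
  + 3 *ℤ term30 m -ℤ σ m
    ∎
  where c = m % 3

T : ℕ → ℤ
T zero    = + 0
T (suc m) = T m +ℤ σ m

S30-difference : ∀ m → + 3 *ℤ S30 m -ℤ S30 (m * 4) ≡ T m
S30-difference zero    = refl
S30-difference (suc m) = begin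
  + 3 *ℤ (S30 m +ℤ term30 m) -ℤ (S30 (m * 4) +ℤ t₀ +ℤ t₁ +ℤ t₂ +ℤ t₃)
    ≡⟨ cong (λ b → + 3 *ℤ (S30 m +ℤ term30 m) -ℤ b) (reassoc (S30 (m * 4)) t₀ t₁ t₂ t₃) ⟩
  + 3 *ℤ (S30 m +ℤ term30 m) -ℤ (S30 (m * 4) +ℤ (t₀ +ℤ t₁ +ℤ t₂ +ℤ t₃))
    ≡⟨ cong (λ b → + 3 *ℤ (S30 m +ℤ term30 m) -ℤ (S30 (m * 4) +ℤ b)) (block-sum m) ⟩
  + 3 *ℤ (S30 m +ℤ term30 m) -ℤ (S30 (m * 4) +ℤ (+ 3 *ℤ term30 m -ℤ σ m))
    ≡⟨ cancel (S30 m) (S30 (m * 4)) (term30 m) (σ m) ⟩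
  (+ 3 *ℤ S30 m -ℤ S30 (m * 4)) +ℤ σ m
    ≡⟨ cong (_+ℤ σ m) (S30-difference m) ⟩
  T m +ℤ σ m
    ∎
  where
  t₀ = term30 (m * 4)
  t₁ = term30 (1 + m * 4)
  t₂ = term30 (2 + m * 4)
  t₃ = term30 (3 + m * 4)
  reassoc : ∀ a b c d e → a +ℤ b +ℤ c +ℤ d +ℤ e ≡ a +ℤ (b +ℤ c +ℤ d +ℤ e)
  reassoc = ℤ-Solver.solve-∀
  cancel : ∀ S S₄ t s → + 3 *ℤ (S +ℤ t) -ℤ (S₄ +ℤ (+ 3 *ℤ t -ℤ s)) ≡ (+ 3 *ℤ S -ℤ S₄) +ℤ s
  cancel = ℤ-Solver.solve-∀

-- Step 4: σ(2s) and σ(2s+1) cancel, so T vanishes at even arguments.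
T-even : ∀ s → T (s * 2) ≡ + 0
T-even zero    = refl
T-even (suc s) = begin
  T (s * 2) +ℤ σ (s * 2) +ℤ σ (1 + s * 2)  ≡⟨ cong₂ (λ a b → a +ℤ σ (s * 2) +ℤ b) (T-even s) (σ-double+1 s) ⟩
  + 0 +ℤ σ (s * 2) +ℤ - σ s                ≡⟨ cong (λ a → + 0 +ℤ a +ℤ - σ s) (σ-double s) ⟩
  + 0 +ℤ σ s +ℤ - σ s                      ≡⟨ cancel (σ s) ⟩
  + 0                                      ∎
  where
  cancel : ∀ v → + 0 +ℤ v +ℤ - v ≡ + 0
  cancel = ℤ-Solver.solve-∀

T-odd : ∀ s → T (1 + s * 2) ≡ σ s
T-odd s = begin
  T (s * 2) +ℤ σ (s * 2)  ≡⟨ cong (_+ℤ σ (s * 2)) (T-even s) ⟩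
  + 0 +ℤ σ (s * 2)        ≡⟨ ℤₚ.+-identityˡ _ ⟩
  σ (s * 2)               ≡⟨ σ-double s ⟩
  σ s                     ∎

A3-of-quotient : ℕ → ℤ
A3-of-quotient zero    = + 0
A3-of-quotient (suc q) = σ q *ℤ T (suc q)

A3-via-quotient : ∀ x → A3 x ≡ A3-of-quotient (x / 4)
A3-via-quotient x with x / 4
... | zero  = refl
... | suc q = cong (σ q *ℤ_) (begin
  + 3 *ℤ S30 (suc q) -ℤ S30 (4 * suc q)  ≡⟨ cong (λ n → + 3 *ℤ S30 (suc q) -ℤ S30 n) (ℕₚ.*-comm 4 (suc q)) ⟩
  + 3 *ℤ S30 (suc q) -ℤ S30 (suc q * 4)  ≡⟨ S30-difference (suc q) ⟩
  T (suc q)                              ∎)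

A3-of-quotient-even : ∀ s → A3-of-quotient (s * 2) ≡ + 0
A3-of-quotient-even zero    = refl
A3-of-quotient-even (suc s) = begin
  σ (1 + s * 2) *ℤ T (suc s * 2)  ≡⟨ cong (σ (1 + s * 2) *ℤ_) (T-even (suc s)) ⟩
  σ (1 + s * 2) *ℤ + 0            ≡⟨ ℤₚ.*-zeroʳ (σ (1 + s * 2)) ⟩
  + 0                             ∎

A3-of-quotient-odd : ∀ s → A3-of-quotient (1 + s * 2) ≡ + 1
A3-of-quotient-odd s = begin
  σ (s * 2) *ℤ T (1 + s * 2)  ≡⟨ cong₂ _*ℤ_ (σ-double s) (T-odd s) ⟩
  σ s *ℤ σ s                  ≡⟨ sign-square (s₂ s) ⟩
  + 1                         ∎

quotient-by-4 : ∀ x → x / 4 ≡ x % 8 / 4 + x / 8 * 2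
quotient-by-4 x = begin
  x / 4                            ≡⟨ cong (_/ 4) (m≡m%n+[m/n]*n x 8) ⟩
  (r + t * 8) / 4                  ≡⟨ cong (λ n → (r + n) / 4) (ℕₚ.*-assoc t 2 4) ⟨
  (r + t * 2 * 4) / 4              ≡⟨ +-distrib-/ r (t * 2 * 4) no-carry ⟩
  r / 4 + t * 2 * 4 / 4            ≡⟨ cong (λ n → r / 4 + n) (m*n/n≡m (t * 2) 4) ⟩
  r / 4 + t * 2                    ∎
  where
  r = x % 8
  t = x / 8
  no-carry : r % 4 + t * 2 * 4 % 4 < 4
  no-carry = subst (λ n → r % 4 + n < 4) (sym (m*n%n≡0 (t * 2) 4))
                   (subst (_< 4) (sym (ℕₚ.+-identityʳ (r % 4))) (m%n<n r 4))

upper-half : ∀ {r} → 4 ≤ r → r < 8 → r / 4 ≡ 1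
upper-half {r} 4≤r r<8 = trans (m/n≡1+[m∸n]/n 4≤r) (cong suc (m<n⇒m/n≡0 (ℕₚ.m<n+o⇒m∸n<o r 4 r<8)))

A3-lower : ∀ x → x % 8 < 4 → A3 x ≡ + 0
A3-lower x r<4 = begin
  A3 x                                    ≡⟨ A3-via-quotient x ⟩
  A3-of-quotient (x / 4)                  ≡⟨ cong A3-of-quotient (quotient-by-4 x) ⟩
  A3-of-quotient (x % 8 / 4 + x / 8 * 2)  ≡⟨ cong (λ n → A3-of-quotient (n + x / 8 * 2)) (m<n⇒m/n≡0 r<4) ⟩
  A3-of-quotient (x / 8 * 2)              ≡⟨ A3-of-quotient-even (x / 8) ⟩
  + 0                                     ∎

A3-upper : ∀ x → 4 ≤ x % 8 → A3 x ≡ + 1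
A3-upper x 4≤r = begin
  A3 x                                    ≡⟨ A3-via-quotient x ⟩
  A3-of-quotient (x / 4)                  ≡⟨ cong A3-of-quotient (quotient-by-4 x) ⟩
  A3-of-quotient (x % 8 / 4 + x / 8 * 2)  ≡⟨ cong (λ n → A3-of-quotient (n + x / 8 * 2)) (upper-half 4≤r (m%n<n x 8)) ⟩
  A3-of-quotient (1 + x / 8 * 2)          ≡⟨ A3-of-quotient-odd (x / 8) ⟩
  + 1                                     ∎

-- Periodicity: x and x + 8 fall into the same half of the residues mod 8.
A3-periodic : ∀ x → A3 (x + 8) ≡ A3 x
A3-periodic x with x % 8 <? 4
... | yes r<4 = trans (A3-lower (x + 8) (subst (_< 4) (sym same-residue) r<4)) (sym (A3-lower x r<4))
  where same-residue = [m+kn]%n≡m%n x 1 8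
... | no  r≮4 = trans (A3-upper (x + 8) (subst (4 ≤_) (sym same-residue) 4≤r)) (sym (A3-upper x 4≤r))
  where
  same-residue = [m+kn]%n≡m%n x 1 8
  4≤r = ℕₚ.≮⇒≥ r≮4

lemma1 : (∀ (x : ℕ) → A3 (x + 8) ≡ A3 x)
       × (∀ (x : ℕ) → x % 8 < 4 → A3 x ≡ + 0)
       × (∀ (x : ℕ) → 4 ≤ x % 8 → A3 x ≡ + 1)
lemma1 = A3-periodic , A3-lower , A3-upper
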